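{- Let $a,b$ be relatively prime integers with $1<a<b$ and $S=\langle a,b\rangle$. If $x\in I_{i,a}(S)$ for some $i\in[1,a-1]$, then either $x+a\in S$ or $x+a\in I_{i,a}(S)$.
   Context: $\langle a,b\rangle=\{\lambda_1a+\lambda_2b:\lambda_1,\lambda_2\in\mathbb{N}\}$. $I(S)$ is the set of isolated gaps of $S$ (elements $x\in\mathbb{N}\setminus S$ with $x-1,x+1\in S$). For $i\in\{1,\dots,a-1\}$, $I_{i,a}(S)=\{s\in I(S): s\equiv i\pmod a\}$. -}

module Defs where

open import Data.Nat using (ℕ; suc; _+_; _*_; _∸_; _%_; _≤_; _<_)
open import Data.Product using (∃₂; _×_)
open import Relation.Binary.PropositionalEquality using (_≡_)
open import Relation.Nullary using (¬_)

InSG : ℕ → ℕ → ℕ → Set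
InSG a b x = ∃₂ λ l₁ l₂ → x ≡ l₁ * a + l₂ * b

-- x is an isolated gap of ⟨a,b⟩: x ∉ S, x - 1 ∈ S, x + 1 ∈ S.
-- (x ≥ 1 is required so that x - 1 is a natural number; 0 ∈ S anyway.)
IsolatedGap : ℕ → ℕ → ℕ → Set
IsolatedGap a b x = 1 ≤ x × ¬ InSG a b x × InSG a b (x ∸ 1) × InSG a b (suc x)

InIia : ℕ → ℕ → ℕ → ℕ → Set
InIia i a b x = IsolatedGap a b x × x % suc (a ∸ 1) ≡ i % suc (a ∸ 1)

{-# OPTIONS --safe #-}
-- Since a ∈ S and S is closed under addition, (x + a) ∓ 1 = (x ∓ 1) + a both lie in S;
-- so if x + a ∉ S it is again an isolated gap, and it has the residue of x modulo a.
-- Membership in ⟨a,b⟩ is decidable, which makes this case split constructive.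
module Submission where

open import Defs
open import Data.Nat using (ℕ; suc; _+_; _*_; _∸_; _≤_; _<_; _≟_; s≤s; NonZero)
open import Data.Nat.Coprimality using (Coprime)
open import Data.Nat.DivMod using ([m+n]%n≡m%n)
open import Data.Nat.Properties
  using (anyUpTo?; m≤m*n; m≤n+m; m≤m+n; ≤-trans; +-∸-comm; *-identityˡ; +-identityʳ)
open import Data.Nat.Solver using (module +-*-Solver)
open import Data.Product using (_×_; _,_; ∃)
open import Data.Sum using (_⊎_; inj₁; inj₂)
open import Relation.Binary.PropositionalEquality using (_≡_; refl; sym; trans; cong₂; subst)
open import Relation.Nullary using (yes; no; ¬_)
open import Relation.Nullary.Decidable using (map′)
open import Relation.Unary using (Decidable)

open +-*-Solver using (solve; _:=_; _:+_; _:*_)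

module _ {a b : ℕ} where

  InSG-generatorˡ : InSG a b a
  InSG-generatorˡ = 1 , 0 , sym (trans (+-identityʳ (1 * a)) (*-identityˡ a))

  InSG-+ : ∀ {x y} → InSG a b x → InSG a b y → InSG a b (x + y)
  InSG-+ (k₁ , k₂ , x≡) (l₁ , l₂ , y≡) =
    k₁ + l₁ , k₂ + l₂ , trans (cong₂ _+_ x≡ y≡) (regroup k₁ k₂ l₁ l₂ a b)
    where
    regroup : ∀ k₁ k₂ l₁ l₂ a b →
      (k₁ * a + k₂ * b) + (l₁ * a + l₂ * b) ≡ (k₁ + l₁) * a + (k₂ + l₂) * b
    regroup = solve 6 (λ k₁ k₂ l₁ l₂ a b →
      (k₁ :* a :+ k₂ :* b) :+ (l₁ :* a :+ l₂ :* b) := (k₁ :+ l₁) :* a :+ (k₂ :+ l₂) :* b) refl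

module _ {a b : ℕ} .{{_ : NonZero a}} .{{_ : NonZero b}} where

  InSG-coefficients-≤ : ∀ {n l₁ l₂} → n ≡ l₁ * a + l₂ * b → l₁ ≤ n × l₂ ≤ n
  InSG-coefficients-≤ {l₁ = l₁} {l₂} refl =
    ≤-trans (m≤m*n l₁ a) (m≤m+n _ _) , ≤-trans (m≤m*n l₂ b) (m≤n+m _ _)

  InSG? : Decidable (InSG a b)
  InSG? n = map′ fromBounded toBounded
    (anyUpTo? (λ l₁ → anyUpTo? (λ l₂ → n ≟ l₁ * a + l₂ * b) (suc n)) (suc n))
    where
    Bounded : Set
    Bounded = ∃ λ l₁ → l₁ < suc n × ∃ λ l₂ → l₂ < suc n × n ≡ l₁ * a + l₂ * b
    fromBounded : Bounded → InSG a b n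
    fromBounded (l₁ , _ , l₂ , _ , n≡) = l₁ , l₂ , n≡
    toBounded : InSG a b n → Bounded
    toBounded (l₁ , l₂ , n≡) with InSG-coefficients-≤ n≡
    ... | l₁≤n , l₂≤n = l₁ , s≤s l₁≤n , l₂ , s≤s l₂≤n , n≡

isolatedGap-+ : ∀ {a b s x} → InSG a b s → IsolatedGap a b x →
                ¬ InSG a b (x + s) → IsolatedGap a b (x + s)
isolatedGap-+ {a} {b} {s} {x} s∈S (1≤x , _ , x∸1∈S , 1+x∈S) x+s∉S =
  ≤-trans 1≤x (m≤m+n x s) ,
  x+s∉S ,
  subst (InSG a b) (sym (+-∸-comm s 1≤x)) (InSG-+ x∸1∈S s∈S) ,
  InSG-+ 1+x∈S s∈S

lemma4p4 : (a b : ℕ) → Coprime a b → 1 < a → a < b →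
    (i x : ℕ) → 1 ≤ i → i ≤ a ∸ 1 → InIia i a b x →
    InSG a b (x + a) ⊎ InIia i a b (x + a)
lemma4p4 a b _ (s≤s (s≤s _)) (s≤s _) i x _ _ (x-gap , x≡i) with InSG? {a} {b} (x + a)
... | yes x+a∈S = inj₁ x+a∈S
... | no  x+a∉S = inj₂ (isolatedGap-+ InSG-generatorˡ x-gap x+a∉S , trans ([m+n]%n≡m%n x a) x≡i)
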